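{- The language $\mathcal{L}\subseteq\tilde\Sigma^*$ of all consistent sequences of measurement outcomes of the Peres–Mermin experiment (defined in the context) is a regular language over the alphabet $\tilde\Sigma$, i.e. it is generated by a regular (right-linear) grammar; equivalently, it is accepted by a finite automaton.
   Context: Let $\Sigma=\{A,B,C,a,b,c,\alpha,\beta,\gamma\}$ be nine observables arranged in a $3\times 3$ array with rows $(A,B,C)$, $(a,b,c)$, $(\alpha,\beta,\gamma)$. The six contexts are the three rows and the three columns, viewed as 3-element sets. Two observables are compatible if they lie in a common context (in particular, every observable is compatible with itself), and incompatible otherwise. Each context has a required product: $+1$ for every context except $\{C,c,\gamma\}$, whose required product is $-1$. Let $\tilde\Sigma=\{A,\tilde A,B,\tilde B,\dots,\gamma,\tilde\gamma\}$ (18 letters). A word over $\tilde\Sigma$ encodes a sequence of measurements: the letter $x$ means "observable $x$ was measured with value $1$", and $\tilde x$ means "observable $x$ was measured with value $-1$". Determination: at each stage every observable is either determined, with a value in $\{1,-1\}$, or undetermined. For the empty word all observables are undetermined. Processing the next measurement (observable $x$, value $v$) proceeds as follows: (i) every observable incompatible with $x$ becomes undetermined, while observables compatible with $x$ keep their status and value; (ii) $x$ becomes determined with value $v$; (iii) as long as some context has exactly two determined observables, its third observable becomes determined with the value that makes the product of the three values equal to the required product of that context. A word $x_1\cdots x_n$ (with values $v_i$) is consistent if for every $i$, whenever the observable $x_i$ is determined after processing the first $i-1$ measurements, its value at that point equals $v_i$. $\mathcal{L}$ is the set of all consistent words; it contains the empty word. -}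

module Defs where

open import Data.Nat using (ℕ; zero; suc)
open import Data.Fin using (Fin; zero; suc) renaming (_≟_ to _≟F_)
open import Data.Bool using (Bool; true; false; if_then_else_; _∨_; _∧_)
open import Data.Maybe using (Maybe; just; nothing)
open import Data.Product using (_×_; _,_; proj₁; proj₂)
open import Data.List using (List; []; _∷_; foldl)
open import Data.Unit using (⊤)
open import Relation.Nullary.Decidable using (⌊_⌋)
open import Relation.Binary.PropositionalEquality using (_≡_)

data Sign : Set where
  plus minus : Sign

_·_ : Sign → Sign → Sign
plus  · s = s
minus · plus = minus
minus · minus = plus

-- Observables: position (row , column) in the 3×3 Peres–Mermin array.
-- Row 0 = (A,B,C), row 1 = (a,b,c), row 2 = (α,β,γ); column j is the j-th entry.
Obs : Set
Obs = Fin 3 × Fin 3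

_=ᵒ_ : Obs → Obs → Bool
(i , j) =ᵒ (k , l) = ⌊ i ≟F k ⌋ ∧ ⌊ j ≟F l ⌋

compatible : Obs → Obs → Bool
compatible (i , j) (k , l) = ⌊ i ≟F k ⌋ ∨ ⌊ j ≟F l ⌋

-- Letters of Σ̃: (x , plus) is the letter x, (x , minus) is x̃.
Letter : Set
Letter = Obs × Sign

Word : Set
Word = List Letter

data Ctx : Set where
  row col : Fin 3 → Ctx

member : Ctx → Fin 3 → Obs
member (row i) j = (i , j)
member (col j) i = (i , j)

required : Ctx → Sign
required (col (suc (suc zero))) = minus
required _ = plus

-- Determination state: nothing = undetermined, just v = determined with value v.
State : Set
State = Obs → Maybe Sign

initial : State
initial _ = nothing

set : State → Obs → Sign → State
set s x v y = if y =ᵒ x then just v else s y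

fill : State → Ctx → Maybe State
fill s k with s (member k zero) | s (member k (suc zero)) | s (member k (suc (suc zero)))
... | just a  | just b  | nothing = just (set s (member k (suc (suc zero))) (a · (b · required k)))
... | just a  | nothing | just c  = just (set s (member k (suc zero)) (a · (c · required k)))
... | nothing | just b  | just c  = just (set s (member k zero) (b · (c · required k)))
... | _       | _       | _       = nothing

contexts : List Ctx
contexts = row zero ∷ row (suc zero) ∷ row (suc (suc zero))
         ∷ col zero ∷ col (suc zero) ∷ col (suc (suc zero)) ∷ []

fillFirst : State → List Ctx → Maybe State
fillFirst s [] = nothing
fillFirst s (k ∷ ks) with fill s k
... | just s' = just s'
... | nothing = fillFirst s ks

-- repeat step (iii) as long as possible; each step determines one more observable,
-- so 9 rounds of fuel suffice to reach the point where no context qualifies.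
saturate : ℕ → State → State
saturate zero s = s
saturate (suc n) s with fillFirst s contexts
... | just s' = saturate n s'
... | nothing = s

forget : State → Obs → State
forget s x y = if compatible x y then s y else nothing

measure : State → Letter → State
measure s (x , v) = saturate 9 (set (forget s x) x v)

ConsistentFrom : State → Word → Set
ConsistentFrom s [] = ⊤
ConsistentFrom s ((x , v) ∷ w) =
  (∀ u → s x ≡ just u → u ≡ v) × ConsistentFrom (measure s (x , v)) w

InL : Word → Set
InL w = ConsistentFrom initial w

record DFA (n : ℕ) : Set where
  field
    start  : Fin n
    δ      : Fin n → Letter → Fin n
    accept : Fin n → Bool

accepts : ∀ {n} → DFA n → Word → Bool
accepts M w = DFA.accept M (foldl (DFA.δ M) (DFA.start M) w)

module Submission where

open import Data.Nat using (ℕ; zero; suc; _^_)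
open import Data.Product using (Σ; ∃-syntax; _,_; proj₂)
open import Data.Bool using (Bool; true; false)
open import Data.Maybe using (Maybe; just; nothing)
open import Data.Maybe.Relation.Binary.Pointwise using (Pointwise; just; nothing)
open import Data.List using ([]; _∷_; foldl)
open import Data.Unit using (tt)
open import Data.Fin using (Fin; zero; suc; combine; remQuot; funToFin; finToFun)
open import Data.Fin.Properties using (remQuot-combine; finToFun-funToFin)
open import Relation.Nullary using (Dec; yes; no; contradiction)
open import Relation.Nullary.Decidable using (map′)
open import Relation.Binary.PropositionalEquality
  using (_≡_; refl; sym; trans; cong; _≗_; module ≡-Reasoning)
open import Function.Bundles using (_⇔_; mk⇔)
open import Function.Construct.Composition using (_⇔-∘_)
open import Function.Construct.Symmetry using (⇔-sym)
open import Defs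

-- The determination status is a map from the nine observables to
-- {undetermined, 1, −1}, so there are at most 3⁹ of them, and whether the rest
-- of a word is consistent depends only on the current status.  Hence the
-- statuses, coded as elements of Fin (3 ^ 9), together with a rejecting sink
-- for the first inconsistent measurement, are the states of a DFA for 𝓛.
-- Decoding a code gives back a status only pointwise, so consistency is first
-- shown to respect pointwise equality of statuses.

set-cong : ∀ {s t} x v → s ≗ t → set s x v ≗ set t x v
set-cong x v s≗t y with y =ᵒ x
... | true  = refl
... | false = s≗t y

forget-cong : ∀ {s t} x → s ≗ t → forget s x ≗ forget t x
forget-cong x s≗t y with compatible x y
... | true  = s≗t y
... | false = refl

fill-cong : ∀ {s t} k → s ≗ t → Pointwise _≗_ (fill s k) (fill t k)
fill-cong {s} {t} k s≗t
  rewrite s≗t (member k zero) | s≗t (member k (suc zero)) | s≗t (member k (suc (suc zero)))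
  with t (member k zero) | t (member k (suc zero)) | t (member k (suc (suc zero)))
... | just _  | just _  | nothing = just (set-cong _ _ s≗t)
... | just _  | nothing | just _  = just (set-cong _ _ s≗t)
... | nothing | just _  | just _  = just (set-cong _ _ s≗t)
... | just _  | just _  | just _  = nothing
... | just _  | nothing | nothing = nothing
... | nothing | just _  | nothing = nothing
... | nothing | nothing | just _  = nothing
... | nothing | nothing | nothing = nothing

fillFirst-cong : ∀ {s t} ks → s ≗ t → Pointwise _≗_ (fillFirst s ks) (fillFirst t ks)
fillFirst-cong [] s≗t = nothing
fillFirst-cong {s} {t} (k ∷ ks) s≗t with fill s k | fill t k | fill-cong k s≗t
... | just _  | just _  | just s′≗t′ = just s′≗t′
... | nothing | nothing | nothing    = fillFirst-cong ks s≗t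

saturate-cong : ∀ {s t} n → s ≗ t → saturate n s ≗ saturate n t
saturate-cong zero s≗t = s≗t
saturate-cong {s} {t} (suc n) s≗t
  with fillFirst s contexts | fillFirst t contexts | fillFirst-cong contexts s≗t
... | just _  | just _  | just s′≗t′ = saturate-cong n s′≗t′
... | nothing | nothing | nothing    = s≗t

measure-cong : ∀ {s t} l → s ≗ t → measure s l ≗ measure t l
measure-cong (x , v) s≗t = saturate-cong 9 (set-cong x v (forget-cong x s≗t))

ConsistentFrom-resp : ∀ {s t} w → s ≗ t → ConsistentFrom s w → ConsistentFrom t w
ConsistentFrom-resp []            s≗t tt                = tt
ConsistentFrom-resp ((x , v) ∷ w) s≗t (agrees , rest) =
  (λ u tx≡u → agrees u (trans (s≗t x) tx≡u)) ,
  ConsistentFrom-resp w (measure-cong (x , v) s≗t) rest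

ConsistentFrom-cong : ∀ {s t} w → s ≗ t → ConsistentFrom s w ⇔ ConsistentFrom t w
ConsistentFrom-cong w s≗t =
  mk⇔ (ConsistentFrom-resp w s≗t) (ConsistentFrom-resp w (λ y → sym (s≗t y)))

statusCode : Maybe Sign → Fin 3
statusCode nothing      = zero
statusCode (just plus)  = suc zero
statusCode (just minus) = suc (suc zero)

statusOf : Fin 3 → Maybe Sign
statusOf zero             = nothing
statusOf (suc zero)       = just plus
statusOf (suc (suc zero)) = just minus

statusOf-statusCode : ∀ m → statusOf (statusCode m) ≡ m
statusOf-statusCode nothing      = refl
statusOf-statusCode (just plus)  = refl
statusOf-statusCode (just minus) = refl

Code : ℕ
Code = 3 ^ 9

encode : State → Fin Code
encode s = funToFin (λ k → statusCode (s (remQuot 3 k)))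

decode : Fin Code → State
decode c (i , j) = statusOf (finToFun c (combine i j))

decode-encode : ∀ s → decode (encode s) ≗ s
decode-encode s (i , j) = begin
  statusOf (finToFun (funToFin status) (combine i j))
    ≡⟨ cong statusOf (finToFun-funToFin status (combine i j)) ⟩
  statusOf (statusCode (s (remQuot 3 (combine i j))))
    ≡⟨ cong (λ y → statusOf (statusCode (s y))) (remQuot-combine i j) ⟩
  statusOf (statusCode (s (i , j)))
    ≡⟨ statusOf-statusCode (s (i , j)) ⟩
  s (i , j) ∎
  where
  open ≡-Reasoning
  status : Fin 9 → Fin 3
  status k = statusCode (s (remQuot 3 k))

_≟ˢ_ : (u v : Sign) → Dec (u ≡ v)
plus  ≟ˢ plus  = yes refl
minus ≟ˢ minus = yes refl
plus  ≟ˢ minus = no (λ ())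
minus ≟ˢ plus  = no (λ ())

Agrees : Maybe Sign → Sign → Set
Agrees m v = ∀ u → m ≡ just u → u ≡ v

agrees? : ∀ m v → Dec (Agrees m v)
agrees? nothing  v = yes (λ _ ())
agrees? (just u) v = map′ (λ { refl _ refl → refl }) (λ agrees → agrees u refl) (u ≟ˢ v)

ConsistentFrom-decode-encode : ∀ s w → ConsistentFrom (decode (encode s)) w ⇔ ConsistentFrom s w
ConsistentFrom-decode-encode s w = ConsistentFrom-cong w (decode-encode s)

-- zero is a rejecting sink; suc c stands for the status decode c.
step : Fin (suc Code) → Letter → Fin (suc Code)
step zero    _       = zero
step (suc c) (x , v) with agrees? (decode c x) v
... | yes _ = suc (encode (measure (decode c) (x , v)))
... | no  _ = zero

live : Fin (suc Code) → Bool
live zero    = false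
live (suc _) = true

sink-absorbing : ∀ w → foldl step zero w ≡ zero
sink-absorbing []      = refl
sink-absorbing (_ ∷ w) = sink-absorbing w

ConsistentFrom⇔live : ∀ c w → ConsistentFrom (decode c) w ⇔ (live (foldl step (suc c) w) ≡ true)
ConsistentFrom⇔live c []            = mk⇔ (λ _ → refl) (λ _ → tt)
ConsistentFrom⇔live c ((x , v) ∷ w) with agrees? (decode c x) v
... | yes agrees =
  ConsistentFrom⇔live (encode s′) w
    ⇔-∘ (⇔-sym (ConsistentFrom-decode-encode s′ w) ⇔-∘ mk⇔ proj₂ (agrees ,_))
  where s′ = measure (decode c) (x , v)
... | no disagrees =
  mk⇔ (λ (agrees , _) → contradiction agrees disagrees)
      (λ sink-live → contradiction (trans (cong live (sym (sink-absorbing w))) sink-live) λ ())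

automaton : DFA (suc Code)
automaton = record { start = suc (encode initial) ; δ = step ; accept = live }

corollary1 : ∃[ n ] Σ (DFA n) (λ M → ∀ w → InL w ⇔ (accepts M w ≡ true))
corollary1 = suc Code , automaton , λ w →
  ConsistentFrom⇔live (encode initial) w ⇔-∘ ⇔-sym (ConsistentFrom-decode-encode initial w)
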